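{- (Canonicity.) In any normal $\mathsf{IEL}^{ - }$-deduction of a formula $A$ with no undischarged assumptions, the last rule applied is the introduction rule for the main connective of $A$.
   Context: Formulas: built from propositional atoms and $\bot$ by $\wedge,\vee,\rightarrow$ and a unary modality $\Box$. $\mathsf{IEL}^{ - }$: NJ introduction/elimination rules for $\wedge,\vee,\rightarrow$, ex falso, and the $\Box$-intro rule (the introduction rule for $\Box$): from deductions of $\Box A_1,\dots,\Box A_n$ and a deduction of $B$ from assumptions $A_1,\dots,A_n,\Delta$, infer $\Box B$, discharging $A_1,\dots,A_n$. Deductions are identified with typed proof terms $x\mid \lambda x.t\mid ts\mid \langle t,s\rangle\mid \pi_i t\mid \mathsf{in}_i t\mid \mathsf{C}_{x,y}(t,t_1,t_2)$ ($\vee$-elim) $\mid \mathsf{E}(t)$ ($\bot$-elim) $\mid \mathsf{B}_{x_1,\dots,x_n}(t_1,\dots,t_n)\,\mathsf{in}\,s$ ($\Box$-intro). A deduction is normal if its term contains no redex of: detours $(\lambda x.t)s> t[x:=s]$, $\pi_i\langle t_1,t_2\rangle> t_i$, $\mathsf{C}_{x_1,x_2}(\mathsf{in}_i t,t_1,t_2)> t_i[x_i:=t]$, $\mathsf{B}_{\dots,x_i,\dots}(\dots,(\mathsf{B}_{\vec y}(\vec s)\,\mathsf{in}\,t_i),\dots)\,\mathsf{in}\,r > \mathsf{B}_{\dots,\vec y,\dots}(\dots,\vec s,\dots)\,\mathsf{in}\,r[x_i:=t_i]$, $\mathsf{B}_x t\,\mathsf{in}\,x> t$; permutations $\mathsf{C}(t,t_1,t_2)s>\mathsf{C}(t,t_1s,t_2s)$,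 $\pi_i\mathsf{C}(t,t_1,t_2)>\mathsf{C}(t,\pi_it_1,\pi_it_2)$, $\mathsf{C}_{u,v}(\mathsf{C}_{x,y}(t,t_1,t_2),s_1,s_2)>\mathsf{C}_{x,y}(t,\mathsf{C}_{u,v}(t_1,s_1,s_2),\mathsf{C}_{u,v}(t_2,s_1,s_2))$, $\mathsf{B}_{\vec x}(\dots,\mathsf{C}_{x,y}(t,s_1,s_2),\dots)\,\mathsf{in}\,s>\mathsf{C}_{x,y}(t,\mathsf{B}_{\vec x}(\dots,s_1,\dots)\,\mathsf{in}\,s,\mathsf{B}_{\vec x}(\dots,s_2,\dots)\,\mathsf{in}\,s)$, $\mathsf{E}(\mathsf{C}(t,t_1,t_2))>\mathsf{C}(t,\mathsf{E}(t_1),\mathsf{E}(t_2))$; $\bot$-conversions $\mathsf{E}(t)s>\mathsf{E}(t)$, $\pi_i\mathsf{E}(t)>\mathsf{E}(t)$, $\mathsf{C}(\mathsf{E}(t),t_1,t_2)>\mathsf{E}(t)$, $\mathsf{E}(\mathsf{E}(t))>\mathsf{E}(t)$, $\mathsf{B}_{\vec x}(\dots,\mathsf{E}(t_i),\dots)\,\mathsf{in}\,s>\mathsf{E}(t_i)$. -}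

module Defs where

open import Data.Nat using (ℕ)
open import Data.List using (List; []; _∷_; _++_)
open import Data.List.Membership.Propositional using (_∈_)
open import Data.List.Relation.Unary.Any using (here)
open import Relation.Binary.PropositionalEquality using (refl)
open import Relation.Nullary using (¬_)

infixr 6 _∧_
infixr 5 _∨_
infixr 4 _⇒_
data Form : Set where
  atom : ℕ → Form
  ⊥′   : Form
  _∧_  : Form → Form → Form
  _∨_  : Form → Form → Form
  _⇒_  : Form → Form → Form
  □_   : Form → Form

-- Contexts of (undischarged) assumptions; variables are de Bruijn indices.
Ctx : Set
Ctx = List Form

-- Typed proof terms = IEL⁻ deductions in NJ style.
-- box {A₁…Aₙ} (t₁ … tₙ) s  is  B_{x₁…xₙ}(t₁,…,tₙ) in s : the tᵢ prove □Aᵢ,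
-- s proves B from A₁,…,Aₙ (the first n variables, discharged) and the
-- ambient assumptions Δ = Γ.
mutual
  data Tm (Γ : Ctx) : Form → Set where
    var  : ∀ {A} → A ∈ Γ → Tm Γ A
    lam  : ∀ {A B} → Tm (A ∷ Γ) B → Tm Γ (A ⇒ B)
    app  : ∀ {A B} → Tm Γ (A ⇒ B) → Tm Γ A → Tm Γ B
    pair : ∀ {A B} → Tm Γ A → Tm Γ B → Tm Γ (A ∧ B)
    fst  : ∀ {A B} → Tm Γ (A ∧ B) → Tm Γ A
    snd  : ∀ {A B} → Tm Γ (A ∧ B) → Tm Γ B
    inl  : ∀ {A B} → Tm Γ A → Tm Γ (A ∨ B)
    inr  : ∀ {A B} → Tm Γ B → Tm Γ (A ∨ B)
    case : ∀ {A B C} → Tm Γ (A ∨ B) → Tm (A ∷ Γ) C → Tm (B ∷ Γ) C → Tm Γ C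
    efq  : ∀ {A} → Tm Γ ⊥′ → Tm Γ A
    box  : ∀ {As B} → Tms Γ As → Tm (As ++ Γ) B → Tm Γ (□ B)

  data Tms (Γ : Ctx) : List Form → Set where
    []  : Tms Γ []
    _∷_ : ∀ {A As} → Tm Γ (□ A) → Tms Γ As → Tms Γ (A ∷ As)

data IsBox {Γ} : ∀ {A} → Tm Γ A → Set where
  isBox : ∀ {As B} {ts : Tms Γ As} {s : Tm (As ++ Γ) B} → IsBox (box ts s)

data IsCase {Γ} : ∀ {A} → Tm Γ A → Set where
  isCase : ∀ {A B C} {t : Tm Γ (A ∨ B)} {t₁ : Tm (A ∷ Γ) C} {t₂ : Tm (B ∷ Γ) C}
         → IsCase (case t t₁ t₂)

data IsEfq {Γ} : ∀ {A} → Tm Γ A → Set where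
  isEfq : ∀ {A} {t : Tm Γ ⊥′} → IsEfq {A = A} (efq t)

data AnyTm {Γ} (P : ∀ {A} → Tm Γ A → Set) : ∀ {As} → Tms Γ As → Set where
  here  : ∀ {A As} {t : Tm Γ (□ A)} {ts : Tms Γ As} → P t → AnyTm P (t ∷ ts)
  there : ∀ {A As} {t : Tm Γ (□ A)} {ts : Tms Γ As} → AnyTm P ts → AnyTm P (t ∷ ts)

data Redex {Γ} : ∀ {A} → Tm Γ A → Set where
  β⇒   : ∀ {A B} {t : Tm (A ∷ Γ) B} {s : Tm Γ A} → Redex (app (lam t) s)
  β∧₁  : ∀ {A B} {t : Tm Γ A} {s : Tm Γ B} → Redex (fst (pair t s))
  β∧₂  : ∀ {A B} {t : Tm Γ A} {s : Tm Γ B} → Redex (snd (pair t s))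
  β∨₁  : ∀ {A B C} {t : Tm Γ A} {t₁ : Tm (A ∷ Γ) C} {t₂ : Tm (B ∷ Γ) C}
       → Redex (case (inl t) t₁ t₂)
  β∨₂  : ∀ {A B C} {t : Tm Γ B} {t₁ : Tm (A ∷ Γ) C} {t₂ : Tm (B ∷ Γ) C}
       → Redex (case (inr t) t₁ t₂)
  β□   : ∀ {As B} {ts : Tms Γ As} {r : Tm (As ++ Γ) B}
       → AnyTm IsBox ts → Redex (box ts r)
  η□   : ∀ {A} {t : Tm Γ (□ A)} → Redex (box (t ∷ []) (var (here refl)))
  πapp  : ∀ {A B} {t : Tm Γ (A ⇒ B)} {s : Tm Γ A} → IsCase t → Redex (app t s)
  πfst  : ∀ {A B} {t : Tm Γ (A ∧ B)} → IsCase t → Redex (fst t)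
  πsnd  : ∀ {A B} {t : Tm Γ (A ∧ B)} → IsCase t → Redex (snd t)
  πcase : ∀ {A B C} {t : Tm Γ (A ∨ B)} {s₁ : Tm (A ∷ Γ) C} {s₂ : Tm (B ∷ Γ) C}
        → IsCase t → Redex (case t s₁ s₂)
  πbox  : ∀ {As B} {ts : Tms Γ As} {s : Tm (As ++ Γ) B}
        → AnyTm IsCase ts → Redex (box ts s)
  πefq  : ∀ {A} {t : Tm Γ ⊥′} → IsCase t → Redex {A = A} (efq t)
  ⊥app  : ∀ {A B} {t : Tm Γ (A ⇒ B)} {s : Tm Γ A} → IsEfq t → Redex (app t s)
  ⊥fst  : ∀ {A B} {t : Tm Γ (A ∧ B)} → IsEfq t → Redex (fst t)
  ⊥snd  : ∀ {A B} {t : Tm Γ (A ∧ B)} → IsEfq t → Redex (snd t)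
  ⊥case : ∀ {A B C} {t : Tm Γ (A ∨ B)} {s₁ : Tm (A ∷ Γ) C} {s₂ : Tm (B ∷ Γ) C}
        → IsEfq t → Redex (case t s₁ s₂)
  ⊥efq  : ∀ {A} {t : Tm Γ ⊥′} → IsEfq t → Redex {A = A} (efq t)
  ⊥box  : ∀ {As B} {ts : Tms Γ As} {s : Tm (As ++ Γ) B}
        → AnyTm IsEfq ts → Redex (box ts s)

mutual
  data HasRedex {Γ} : ∀ {A} → Tm Γ A → Set where
    here  : ∀ {A} {t : Tm Γ A} → Redex t → HasRedex t
    lam   : ∀ {A B} {t : Tm (A ∷ Γ) B} → HasRedex t → HasRedex (lam t)
    app₁  : ∀ {A B} {t : Tm Γ (A ⇒ B)} {s : Tm Γ A} → HasRedex t → HasRedex (app t s)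
    app₂  : ∀ {A B} {t : Tm Γ (A ⇒ B)} {s : Tm Γ A} → HasRedex s → HasRedex (app t s)
    pair₁ : ∀ {A B} {t : Tm Γ A} {s : Tm Γ B} → HasRedex t → HasRedex (pair t s)
    pair₂ : ∀ {A B} {t : Tm Γ A} {s : Tm Γ B} → HasRedex s → HasRedex (pair t s)
    fst   : ∀ {A B} {t : Tm Γ (A ∧ B)} → HasRedex t → HasRedex (fst t)
    snd   : ∀ {A B} {t : Tm Γ (A ∧ B)} → HasRedex t → HasRedex (snd t)
    inl   : ∀ {A B} {t : Tm Γ A} → HasRedex t → HasRedex (inl {B = B} t)
    inr   : ∀ {A B} {t : Tm Γ B} → HasRedex t → HasRedex (inr {A = A} t)
    case₀ : ∀ {A B C} {t : Tm Γ (A ∨ B)} {t₁ : Tm (A ∷ Γ) C} {t₂ : Tm (B ∷ Γ) C}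
          → HasRedex t → HasRedex (case t t₁ t₂)
    case₁ : ∀ {A B C} {t : Tm Γ (A ∨ B)} {t₁ : Tm (A ∷ Γ) C} {t₂ : Tm (B ∷ Γ) C}
          → HasRedex t₁ → HasRedex (case t t₁ t₂)
    case₂ : ∀ {A B C} {t : Tm Γ (A ∨ B)} {t₁ : Tm (A ∷ Γ) C} {t₂ : Tm (B ∷ Γ) C}
          → HasRedex t₂ → HasRedex (case t t₁ t₂)
    efq   : ∀ {A} {t : Tm Γ ⊥′} → HasRedex t → HasRedex {A = A} (efq t)
    boxᵢ  : ∀ {As B} {ts : Tms Γ As} {s : Tm (As ++ Γ) B}
          → HasRedexs ts → HasRedex (box ts s)
    boxₛ  : ∀ {As B} {ts : Tms Γ As} {s : Tm (As ++ Γ) B}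
          → HasRedex s → HasRedex (box ts s)

  data HasRedexs {Γ} : ∀ {As} → Tms Γ As → Set where
    here  : ∀ {A As} {t : Tm Γ (□ A)} {ts : Tms Γ As} → HasRedex t → HasRedexs (t ∷ ts)
    there : ∀ {A As} {t : Tm Γ (□ A)} {ts : Tms Γ As} → HasRedexs ts → HasRedexs (t ∷ ts)

Normal : ∀ {Γ A} → Tm Γ A → Set
Normal t = ¬ HasRedex t

-- the last rule of t is the introduction rule for the main connective of
-- its conclusion (the index A forces the connective to match; there is no
-- introduction rule for atoms or ⊥)
data LastRuleIntro {Γ} : ∀ {A} → Tm Γ A → Set where
  ⇒I  : ∀ {A B} {t : Tm (A ∷ Γ) B} → LastRuleIntro (lam t)
  ∧I  : ∀ {A B} {t : Tm Γ A} {s : Tm Γ B} → LastRuleIntro (pair t s)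
  ∨I₁ : ∀ {A B} {t : Tm Γ A} → LastRuleIntro (inl {B = B} t)
  ∨I₂ : ∀ {A B} {t : Tm Γ B} → LastRuleIntro (inr {A = A} t)
  □I  : ∀ {As B} {ts : Tms Γ As} {s : Tm (As ++ Γ) B} → LastRuleIntro (box ts s)

module Submission where

open import Defs
open import Data.List using ([])
open import Data.Empty using (⊥-elim)

-- Induction on the deduction: the major premise of a final elimination is
-- again closed and normal, hence ends in the matching introduction, and
-- that pair forms a detour. No closed normal deduction ends in ⊥-elim,
-- since ⊥ has no introduction; so permutations and ⊥-conversions never arise.

lemma30 : ∀ {A : Form} (t : Tm [] A) → Normal t → LastRuleIntro t
lemma30 (var ())
lemma30 (lam _)    _ = ⇒I
lemma30 (pair _ _) _ = ∧I
lemma30 (inl _)    _ = ∨I₁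
lemma30 (inr _)    _ = ∨I₂
lemma30 (box _ _)  _ = □I
lemma30 (app t _) nf with lemma30 t (λ r → nf (app₁ r))
... | ⇒I = ⊥-elim (nf (here β⇒))
lemma30 (fst t) nf with lemma30 t (λ r → nf (fst r))
... | ∧I = ⊥-elim (nf (here β∧₁))
lemma30 (snd t) nf with lemma30 t (λ r → nf (snd r))
... | ∧I = ⊥-elim (nf (here β∧₂))
lemma30 (case t _ _) nf with lemma30 t (λ r → nf (case₀ r))
... | ∨I₁ = ⊥-elim (nf (here β∨₁))
... | ∨I₂ = ⊥-elim (nf (here β∨₂))
lemma30 (efq t) nf with lemma30 t (λ r → nf (efq r))
... | ()
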